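{- For every integer $q \geq 2$, \[ \frac{1}{q} < \mathbb{I}(Z_2,q) < \frac{1}{q-1}. \] Moreover, as $q \to \infty$, \[ \mathbb{I}(Z_2,q) = \frac{1}{q-1} - \frac{1+o(1)}{q^3}. \]
   Context: $Z_2 = aba$. A word $U$ is an instance of $aba$ if $U = XYX$ for some nonempty words $X,Y$. For $q\ge 1$, $[q]=\{1,\dots,q\}$; $\mathbb{I}_n(Z_2,q)$ is the probability that a uniformly random word in $[q]^n$ is an instance of $Z_2$, and $\mathbb{I}(Z_2,q)=\lim_{n\to\infty}\mathbb{I}_n(Z_2,q)$ (this limit exists). -}

module Defs where

open import Data.Nat using (ℕ; zero; suc; _^_)
open import Data.Fin using (Fin)
open import Data.List using (List; []; _∷_; _++_; map; concatMap; filter; length)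
open import Data.Fin using () renaming (zero to fz)
open import Data.List using () renaming ([_] to singleton)
import Data.Nat.Properties
open import Data.Integer using (+_)
open import Data.Rational using (ℚ; _/_; 0ℚ)
open import Data.Product using (∃; ∃₂; _×_; _,_)
open import Relation.Nullary using (Dec; ¬_)
open import Relation.Binary.PropositionalEquality using (_≡_)
import Data.List as L

Word : ℕ → Set
Word q = List (Fin q)

-- U is an instance of Z₂ = aba : U = X Y X with X, Y nonempty.
IsInstance : {q : ℕ} → Word q → Set
IsInstance {q} U =
  ∃₂ λ (X Y : Word q) → (¬ X ≡ []) × (¬ Y ≡ []) × (U ≡ X ++ Y ++ X)

-- All words of length n over [q] (each exactly once).
allWords : (q n : ℕ) → List (Word q)
allWords q zero    = [] ∷ []
allWords q (suc n) = concatMap (λ w → map (λ a → a ∷ w) (L.allFin q)) (allWords q n)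

-- Number of words of length n over [q] that are instances of Z₂,
-- computed from any decision procedure for IsInstance (the count does not
-- depend on which procedure is used).
count : (dec : ∀ {q} (U : Word q) → Dec (IsInstance U)) → (q n : ℕ) → ℕ
count dec q n = length (filter dec (allWords q n))

-- 𝕀ₙ(Z₂,q) = count / qⁿ  (q = 0 is never used; it is given the value 0).
Iₙ : (dec : ∀ {q} (U : Word q) → Dec (IsInstance U)) → (q n : ℕ) → ℚ
Iₙ dec zero    n = 0ℚ
Iₙ dec (suc q) n = (+ count dec (suc q) n) / (suc q ^ n)
  where instance _ = Data.Nat.Properties.m^n≢0 (suc q) n

-- 1/m as a rational (m = 0 never used; value 0).
inv : ℕ → ℚ
inv zero    = 0ℚ
inv (suc m) = (+ 1) / suc m

module Submission where

-- A word U is an instance of aba iff it has a border of length k (its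
-- prefix and suffix of length k agree) with 1 ≤ k and 2k < |U|.  Writing
-- b_k for the indicator of a border of length k, for |U| = n ≥ 7:
--   * (upper) 𝟙[U instance] + b₁b₂ ≤ b₁ + b₂ + Σ_{3 ≤ k, 2k < n} b_k,
--   * (lower) b₁ + b₂ + b₃ ≤ 𝟙[U instance] + b₁b₂ + b₃(b₁ ∨ b₂)
--     (inclusion–exclusion, using that b_j b_k = 1 makes the prefix of
--     length k have a border of length j).
-- Words of length n = k + m + k with a border of length k, weighted by a
-- function of their prefix, are counted by splitting U = X M Z (the middle
-- is free, X determines Z); in particular q^(n-k) words have a border of
-- length k.  Summing the pointwise bounds over all words (WordSums,
-- Borders, BorderCounts, InstanceCounts) gives, with c the number of
-- instances and P = q^(n-4),
--   q³P + q²P + qP ≤ c + qP + P,   c + qP ≤ q³P + q²P + (q + ⋯ + q^(n-3)).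

open import Data.Nat using (ℕ)
open import Defs using (Word; IsInstance)
open import Relation.Nullary using (Dec)

module Indicator where

  open import Data.Nat using (_≤_; _*_; z≤n; s≤s)
  open import Relation.Nullary using (Dec; yes; no; ¬_; _×-dec_)
  open import Relation.Nullary.Negation using (contradiction)
  open import Relation.Binary.PropositionalEquality using (_≡_; refl; sym)

  𝟙 : {P : Set} → Dec P → ℕ
  𝟙 (yes _) = 1
  𝟙 (no _)  = 0

  private variable
    P Q : Set

  𝟙-yes : P → (d : Dec P) → 𝟙 d ≡ 1
  𝟙-yes _ (yes _) = refl
  𝟙-yes x (no ¬x) = contradiction x ¬x

  𝟙-no : ¬ P → (d : Dec P) → 𝟙 d ≡ 0
  𝟙-no ¬x (yes x) = contradiction x ¬x
  𝟙-no _  (no _)  = refl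

  𝟙-cong : (P → Q) → (Q → P) → (d : Dec P) (e : Dec Q) → 𝟙 d ≡ 𝟙 e
  𝟙-cong to from (yes x) e = sym (𝟙-yes (to x) e)
  𝟙-cong to from (no ¬x) e = sym (𝟙-no (λ y → ¬x (from y)) e)

  𝟙-× : (d : Dec P) (e : Dec Q) → 𝟙 (d ×-dec e) ≡ 𝟙 d * 𝟙 e
  𝟙-× (yes _) (yes _) = refl
  𝟙-× (yes _) (no _)  = refl
  𝟙-× (no _)  _       = refl

  𝟙≤1 : (d : Dec P) → 𝟙 d ≤ 1
  𝟙≤1 (yes _) = s≤s z≤n
  𝟙≤1 (no _)  = z≤n

  data Bit : ℕ → Set where
    0b : Bit 0
    1b : Bit 1

  bit : ∀ {n} → n ≤ 1 → Bit n
  bit z≤n       = 0b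
  bit (s≤s z≤n) = 1b

module WordSums (q : ℕ) where

  open import Defs using (allWords; count)
  open import Data.Nat
  open import Data.Nat.Properties
  open import Data.Fin as Fin using (Fin)
  import Data.Fin.Properties as FinP
  open import Data.List as List using (List; []; _∷_; _++_; length; filter; concatMap; map)
  open import Data.List.Properties using (map-++; map-tabulate)
  import Data.Nat.ListAction as ListAction
  open import Data.Nat.ListAction.Properties using (sum-++)
  open import Algebra.Properties.Semiring.Sum +-*-semiring
    using (sum; ∑-comm; ∑-distrib-+; *-distribˡ-sum; sum-cong-≗; sum-replicate-zero)
  open import Relation.Nullary using (yes; no)
  open import Relation.Binary.PropositionalEquality
  open ≡-Reasoning
  open Indicator

  Σℓ : (Fin q → ℕ) → ℕ
  Σℓ = sum

  Σℓ-mono : {f g : Fin q → ℕ} → (∀ a → f a ≤ g a) → Σℓ f ≤ Σℓ g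
  Σℓ-mono = go
    where
    go : ∀ {k} {f g : Fin k → ℕ} → (∀ a → f a ≤ g a) → sum f ≤ sum g
    go {zero}  _   = z≤n
    go {suc k} f≤g = +-mono-≤ (f≤g Fin.zero) (go (λ a → f≤g (Fin.suc a)))

  Σℓ-const : ∀ c → Σℓ (λ _ → c) ≡ c * q
  Σℓ-const c = go q
    where
    go : ∀ k → sum {k} (λ _ → c) ≡ c * k
    go zero    = sym (*-zeroʳ c)
    go (suc k) = trans (cong (c +_) (go k)) (sym (*-suc c k))

  Σℓ-pick : ∀ (x : Fin q) (h : Fin q → ℕ) → Σℓ (λ a → 𝟙 (x Fin.≟ a) * h a) ≡ h x
  Σℓ-pick = go
    where
    go : ∀ {k} (x : Fin k) (h : Fin k → ℕ) → sum (λ a → 𝟙 (x Fin.≟ a) * h a) ≡ h x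
    go {suc k} Fin.zero h =
      trans (cong₂ _+_ (*-identityˡ (h Fin.zero)) (sum-replicate-zero k)) (+-identityʳ (h Fin.zero))
    go {suc k} (Fin.suc x) h =
      trans (sum-cong-≗ shift) (go x (λ a → h (Fin.suc a)))
      where
      shift : ∀ a → 𝟙 (Fin.suc x Fin.≟ Fin.suc a) * h (Fin.suc a) ≡ 𝟙 (x Fin.≟ a) * h (Fin.suc a)
      shift a = cong (_* h (Fin.suc a))
        (𝟙-cong FinP.suc-injective (cong Fin.suc) (Fin.suc x Fin.≟ Fin.suc a) (x Fin.≟ a))

  Σw : ℕ → (Word q → ℕ) → ℕ
  Σw zero    f = f []
  Σw (suc n) f = Σw n (λ w → Σℓ (λ a → f (a ∷ w)))

  Σw-cong : ∀ n {f g : Word q → ℕ} → (∀ w → length w ≡ n → f w ≡ g w) → Σw n f ≡ Σw n g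
  Σw-cong zero    f≡g = f≡g [] refl
  Σw-cong (suc n) f≡g = Σw-cong n (λ w ∣w∣ → sum-cong-≗ (λ a → f≡g (a ∷ w) (cong suc ∣w∣)))

  Σw-mono : ∀ n {f g : Word q → ℕ} → (∀ w → length w ≡ n → f w ≤ g w) → Σw n f ≤ Σw n g
  Σw-mono zero    f≤g = f≤g [] refl
  Σw-mono (suc n) f≤g = Σw-mono n (λ w ∣w∣ → Σℓ-mono (λ a → f≤g (a ∷ w) (cong suc ∣w∣)))

  Σw-+ : ∀ n (f g : Word q → ℕ) → Σw n (λ w → f w + g w) ≡ Σw n f + Σw n g
  Σw-+ zero    f g = refl
  Σw-+ (suc n) f g =
    trans (Σw-cong n (λ w _ → ∑-distrib-+ (λ a → f (a ∷ w)) (λ a → g (a ∷ w)))) (Σw-+ n _ _)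

  Σw-*ˡ : ∀ n c (f : Word q → ℕ) → Σw n (λ w → c * f w) ≡ c * Σw n f
  Σw-*ˡ zero    c f = refl
  Σw-*ˡ (suc n) c f =
    trans (Σw-cong n (λ w _ → sym (*-distribˡ-sum c (λ a → f (a ∷ w))))) (Σw-*ˡ n c _)

  Σw-const : ∀ n c → Σw n (λ _ → c) ≡ c * q ^ n
  Σw-const zero    c = sym (*-identityʳ c)
  Σw-const (suc n) c = begin
    Σw n (λ _ → Σℓ (λ _ → c)) ≡⟨ Σw-cong n (λ _ _ → Σℓ-const c) ⟩
    Σw n (λ _ → c * q)        ≡⟨ Σw-const n (c * q) ⟩
    c * q * q ^ n             ≡⟨ *-assoc c q (q ^ n) ⟩
    c * q ^ suc n             ∎

  Σw-Σℓ : ∀ n (h : Fin q → Word q → ℕ) → Σw n (λ w → Σℓ (λ a → h a w)) ≡ Σℓ (λ a → Σw n (h a))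
  Σw-Σℓ zero    h = refl
  Σw-Σℓ (suc n) h = begin
    Σw n (λ w → Σℓ (λ b → Σℓ (λ a → h a (b ∷ w))))  ≡⟨ Σw-cong n (λ w _ → ∑-comm (λ b a → h a (b ∷ w))) ⟩
    Σw n (λ w → Σℓ (λ a → Σℓ (λ b → h a (b ∷ w))))  ≡⟨ Σw-Σℓ n (λ a w → Σℓ (λ b → h a (b ∷ w))) ⟩
    Σℓ (λ a → Σw n (λ w → Σℓ (λ b → h a (b ∷ w))))  ∎

  Σw-++ : ∀ a b (f : Word q → ℕ) → Σw (a + b) f ≡ Σw a (λ u → Σw b (λ v → f (u ++ v)))
  Σw-++ zero    b f = refl
  Σw-++ (suc a) b f = begin
    Σw (a + b) (λ w → Σℓ (λ x → f (x ∷ w)))                 ≡⟨ Σw-++ a b _ ⟩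
    Σw a (λ u → Σw b (λ v → Σℓ (λ x → f (x ∷ (u ++ v)))))  ≡⟨ Σw-cong a (λ u _ → Σw-Σℓ b (λ x v → f (x ∷ (u ++ v)))) ⟩
    Σw a (λ u → Σℓ (λ x → Σw b (λ v → f (x ∷ (u ++ v)))))  ∎

  count-Σw : (dec : ∀ {q} (U : Word q) → Dec (IsInstance U)) → ∀ n →
             count dec q n ≡ Σw n (λ U → 𝟙 (dec U))
  count-Σw dec n = trans (length-filter (allWords q n)) (Σlist-allWords n _)
    where
    Σlist : (Word q → ℕ) → List (Word q) → ℕ
    Σlist f ws = ListAction.sum (map f ws)

    length-filter : ∀ ws → length (filter dec ws) ≡ Σlist (λ U → 𝟙 (dec U)) ws
    length-filter []       = refl
    length-filter (w ∷ ws) with dec w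
    ... | yes _ = cong suc (length-filter ws)
    ... | no _  = length-filter ws

    Σlist-concatMap : ∀ f (g : Word q → List (Word q)) ws →
                      Σlist f (concatMap g ws) ≡ Σlist (λ w → Σlist f (g w)) ws
    Σlist-concatMap f g []       = refl
    Σlist-concatMap f g (w ∷ ws) = begin
      ListAction.sum (map f (g w ++ concatMap g ws))          ≡⟨ cong ListAction.sum (map-++ f (g w) _) ⟩
      ListAction.sum (map f (g w) ++ map f (concatMap g ws))  ≡⟨ sum-++ (map f (g w)) _ ⟩
      Σlist f (g w) + Σlist f (concatMap g ws)                ≡⟨ cong (_ +_) (Σlist-concatMap f g ws) ⟩
      Σlist f (g w) + Σlist (λ w → Σlist f (g w)) ws          ∎

    Σlist-tabulate : ∀ {k} (h : Fin k → ℕ) → ListAction.sum (List.tabulate h) ≡ sum h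
    Σlist-tabulate {zero}  h = refl
    Σlist-tabulate {suc k} h = cong (h Fin.zero +_) (Σlist-tabulate (λ a → h (Fin.suc a)))

    Σlist-allWords : ∀ n f → Σlist f (allWords q n) ≡ Σw n f
    Σlist-allWords zero    f = +-identityʳ (f [])
    Σlist-allWords (suc n) f = begin
      Σlist f (concatMap (λ w → map (_∷ w) (List.allFin q)) (allWords q n))
        ≡⟨ Σlist-concatMap f _ (allWords q n) ⟩
      Σlist (λ w → Σlist f (map (_∷ w) (List.allFin q))) (allWords q n)
        ≡⟨ Σlist-allWords n _ ⟩
      Σw n (λ w → Σlist f (map (_∷ w) (List.allFin q)))
        ≡⟨ Σw-cong n (λ w _ → trans (cong (Σlist f) (map-tabulate (λ a → a) (_∷ w)))
                                     (trans (cong ListAction.sum (map-tabulate (_∷ w) f))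
                                            (Σlist-tabulate (λ a → f (a ∷ w))))) ⟩
      Σw n (λ w → Σℓ (λ a → f (a ∷ w)))  ∎

module Borders (q : ℕ) where

  open import Data.Nat
  open import Data.Nat.Properties
  open import Data.Fin as Fin using (Fin)
  open import Data.List using ([]; _∷_; _++_; length; take; drop)
  open import Data.List.Properties using (≡-dec; ++-assoc; length-++; length-take; take-take; drop-drop)
  open import Data.Product using (∃; ∃₂; _×_; _,_)
  open import Data.Nat.Tactic.RingSolver using (solve-∀)
  open import Relation.Nullary using (¬_)
  open import Relation.Nullary.Negation using (contradiction)
  open import Relation.Binary.Definitions using (DecidableEquality)
  open import Relation.Binary.PropositionalEquality
  open ≡-Reasoning
  open Indicator

  infix 4 _≟ʷ_
  _≟ʷ_ : DecidableEquality (Word q)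
  _≟ʷ_ = ≡-dec Fin._≟_

  suffix : ℕ → Word q → Word q
  suffix k U = drop (length U ∸ k) U

  Bordered : ℕ → Word q → Set
  Bordered k U = take k U ≡ suffix k U

  border : ℕ → Word q → ℕ
  border k U = 𝟙 (take k U ≟ʷ suffix k U)

  border≤1 : ∀ k U → border k U ≤ 1
  border≤1 k U = 𝟙≤1 (take k U ≟ʷ suffix k U)

  take-++ : ∀ k (X Y : Word q) → length X ≡ k → take k (X ++ Y) ≡ X
  take-++ zero    []      Y _   = refl
  take-++ (suc k) (x ∷ X) Y ∣X∣ = cong (x ∷_) (take-++ k X Y (suc-injective ∣X∣))

  drop-++ : ∀ k (X Y : Word q) → length X ≡ k → drop k (X ++ Y) ≡ Y
  drop-++ zero    []      Y _   = refl
  drop-++ (suc k) (x ∷ X) Y ∣X∣ = drop-++ k X Y (suc-injective ∣X∣)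

  suffix-++ : ∀ k (Y Z : Word q) → length Z ≡ k → suffix k (Y ++ Z) ≡ Z
  suffix-++ k Y Z ∣Z∣ = begin
    drop (length (Y ++ Z) ∸ k) (Y ++ Z)  ≡⟨ cong (λ i → drop i (Y ++ Z)) ∣Y++Z∣∸k ⟩
    drop (length Y) (Y ++ Z)             ≡⟨ drop-++ (length Y) Y Z refl ⟩
    Z                                    ∎
    where
    ∣Y++Z∣∸k : length (Y ++ Z) ∸ k ≡ length Y
    ∣Y++Z∣∸k = trans (cong (_∸ k) (trans (length-++ Y) (cong (length Y +_) ∣Z∣))) (m+n∸n≡m (length Y) k)

  suffix-++₃ : ∀ k (X M Z : Word q) → length Z ≡ k → suffix k (X ++ M ++ Z) ≡ Z
  suffix-++₃ k X M Z ∣Z∣ = trans (cong (suffix k) (sym (++-assoc X M Z))) (suffix-++ k (X ++ M) Z ∣Z∣)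

  border-++ : ∀ k (X M Z : Word q) → length X ≡ k → length Z ≡ k →
              border k (X ++ M ++ Z) ≡ 𝟙 (X ≟ʷ Z)
  border-++ k X M Z ∣X∣ ∣Z∣ =
    cong₂ (λ A B → 𝟙 (A ≟ʷ B)) (take-++ k X (M ++ Z) ∣X∣) (suffix-++₃ k X M Z ∣Z∣)

  border-nest : ∀ {j k} (U : Word q) → j ≤ k → k ≤ length U → Bordered k U →
                border j (take k U) ≡ border j U
  border-nest {j} {k} U j≤k k≤∣U∣ bordered =
    cong₂ (λ A B → 𝟙 (A ≟ʷ B)) (trans (take-take j k U) (cong (λ i → take i U) (m≤n⇒m⊓n≡m j≤k))) suffix≡
    where
    ∣take∣ : length (take k U) ≡ k
    ∣take∣ = trans (length-take k U) (m≤n⇒m⊓n≡m k≤∣U∣)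
    offsets : length U ∸ k + (k ∸ j) ≡ length U ∸ j
    offsets = trans (sym (+-∸-assoc (length U ∸ k) j≤k)) (cong (_∸ j) (m∸n+n≡m k≤∣U∣))
    suffix≡ : suffix j (take k U) ≡ suffix j U
    suffix≡ = begin
      drop (length (take k U) ∸ j) (take k U)  ≡⟨ cong (λ i → drop (i ∸ j) (take k U)) ∣take∣ ⟩
      drop (k ∸ j) (take k U)                  ≡⟨ cong (drop (k ∸ j)) bordered ⟩
      drop (k ∸ j) (suffix k U)                ≡⟨ drop-drop (length U ∸ k) (k ∸ j) U ⟩
      drop (length U ∸ k + (k ∸ j)) U          ≡⟨ cong (λ i → drop i U) offsets ⟩
      suffix j U                               ∎

  split : ∀ a b (U : Word q) → length U ≡ a + b →
          ∃₂ λ X Y → length X ≡ a × length Y ≡ b × U ≡ X ++ Y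
  split zero    b U       ∣U∣ = [] , U , refl , ∣U∣ , refl
  split (suc a) b (x ∷ U) ∣U∣ with split a b U (suc-injective ∣U∣)
  ... | X , Y , ∣X∣ , ∣Y∣ , U≡ = x ∷ X , Y , cong suc ∣X∣ , ∣Y∣ , cong (x ∷_) U≡

  border-middle-border : ∀ a o → suc (a + a) + o ≡ a + (suc o + a)
  border-middle-border = solve-∀

  instance⇒bordered : ∀ (U : Word q) → IsInstance U →
    ∃ λ k → suc (suc k + suc k) ≤ length U × Bordered (suc k) U
  instance⇒bordered U ([] , _ , X≢[] , _ , _) = contradiction refl X≢[]
  instance⇒bordered U (_ , [] , _ , Y≢[] , _) = contradiction refl Y≢[]
  instance⇒bordered U (X@(_ ∷ X′) , M@(_ ∷ M′) , _ , _ , refl) =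
    length X′ , ≤-trans (m≤m+n _ (length M′)) (≤-reflexive (sym ∣U∣)) , trans (take-++ _ X (M ++ X) refl) (sym (suffix-++₃ _ X M X refl))
    where
    ∣U∣ : length (X ++ M ++ X) ≡ suc (length X + length X) + length M′
    ∣U∣ = begin
      length (X ++ M ++ X)                  ≡⟨ length-++ X ⟩
      length X + length (M ++ X)            ≡⟨ cong (length X +_) (length-++ M) ⟩
      length X + (suc (length M′) + length X) ≡⟨ sym (border-middle-border (length X) (length M′)) ⟩
      suc (length X + length X) + length M′   ∎

  bordered⇒instance : ∀ k (U : Word q) → suc (suc k + suc k) ≤ length U →
                      Bordered (suc k) U → IsInstance U
  bordered⇒instance k U 2k<∣U∣ bordered with m≤n⇒∃[o]m+o≡n 2k<∣U∣
  ... | o , ∣U∣ with split (suc k) (suc o + suc k) U (trans (sym ∣U∣) (border-middle-border (suc k) o))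
  ... | X , R , ∣X∣ , ∣R∣ , refl with split (suc o) (suc k) R ∣R∣
  ... | M , Z , ∣M∣ , ∣Z∣ , refl = X , M , nonempty X ∣X∣ , nonempty M ∣M∣ , cong (λ W → X ++ M ++ W) (sym X≡Z)
    where
    nonempty : ∀ (W : Word q) {i} → length W ≡ suc i → ¬ W ≡ []
    nonempty (_ ∷ _) _ ()
    X≡Z : X ≡ Z
    X≡Z = trans (sym (take-++ (suc k) X (M ++ Z) ∣X∣)) (trans bordered (suffix-++₃ (suc k) X M Z ∣Z∣))

module BorderCounts (q : ℕ) where

  open import Data.Nat
  open import Data.Nat.Properties
  open import Data.Nat.Tactic.RingSolver using (solve-∀)
  open import Data.Fin as Fin using (Fin)
  open import Data.List using ([]; _∷_; _++_; length; take)
  open import Data.List.Properties using (∷-injective)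
  open import Algebra.Properties.Semiring.Sum +-*-semiring using (*-distribˡ-sum; sum-cong-≗)
  open import Data.Product using (∃; _×_; _,_; uncurry)
  open import Relation.Nullary using (_×-dec_)
  open import Relation.Binary.PropositionalEquality
  open ≡-Reasoning
  open Indicator
  open WordSums q
  open Borders q

  Σw-pick : ∀ (X : Word q) (h : Word q → ℕ) → Σw (length X) (λ Z → 𝟙 (X ≟ʷ Z) * h Z) ≡ h X
  Σw-pick []      h = *-identityˡ (h [])
  Σw-pick (x ∷ X) h = begin
    Σw (length X) (λ W → Σℓ (λ a → 𝟙 (x ∷ X ≟ʷ a ∷ W) * h (a ∷ W)))
      ≡⟨ Σw-cong (length X) (λ W _ → trans (sum-cong-≗ {q} (factor W)) (sym (*-distribˡ-sum (𝟙 (X ≟ʷ W)) (picked W)))) ⟩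
    Σw (length X) (λ W → 𝟙 (X ≟ʷ W) * Σℓ (λ a → 𝟙 (x Fin.≟ a) * h (a ∷ W)))
      ≡⟨ Σw-pick X (λ W → Σℓ (λ a → 𝟙 (x Fin.≟ a) * h (a ∷ W))) ⟩
    Σℓ (λ a → 𝟙 (x Fin.≟ a) * h (a ∷ X))
      ≡⟨ Σℓ-pick x (λ a → h (a ∷ X)) ⟩
    h (x ∷ X)  ∎
    where
    picked : Word q → Fin q → ℕ
    picked W a = 𝟙 (x Fin.≟ a) * h (a ∷ W)
    exchange : ∀ a b c → a * b * c ≡ b * (a * c)
    exchange = solve-∀
    factor : ∀ W a → 𝟙 (x ∷ X ≟ʷ a ∷ W) * h (a ∷ W) ≡ 𝟙 (X ≟ʷ W) * (𝟙 (x Fin.≟ a) * h (a ∷ W))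
    factor W a = trans (cong (_* h (a ∷ W)) 𝟙-∷) (exchange (𝟙 (x Fin.≟ a)) (𝟙 (X ≟ʷ W)) (h (a ∷ W)))
      where
      𝟙-∷ : 𝟙 (x ∷ X ≟ʷ a ∷ W) ≡ 𝟙 (x Fin.≟ a) * 𝟙 (X ≟ʷ W)
      𝟙-∷ = trans (𝟙-cong ∷-injective (uncurry (cong₂ _∷_)) (x ∷ X ≟ʷ a ∷ W) (x Fin.≟ a ×-dec X ≟ʷ W))
                  (𝟙-× (x Fin.≟ a) (X ≟ʷ W))

  -- Weighted count of the words of length k + m + k with a border of
  -- length k: the middle part is free and the prefix determines the suffix.
  Σw-border-middle : ∀ k m (g : Word q → ℕ) →
              Σw (k + (m + k)) (λ U → border k U * g (take k U)) ≡ q ^ m * Σw k g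
  Σw-border-middle k m g = begin
    Σw (k + (m + k)) F                                       ≡⟨ Σw-++ k (m + k) F ⟩
    Σw k (λ X → Σw (m + k) (λ R → F (X ++ R)))               ≡⟨ Σw-cong k (λ X _ → Σw-++ m k _) ⟩
    Σw k (λ X → Σw m (λ M → Σw k (λ Z → F (X ++ M ++ Z))))   ≡⟨ Σw-cong k (λ X ∣X∣ → Σw-cong m (λ M _ → matching X M ∣X∣)) ⟩
    Σw k (λ X → Σw m (λ _ → g X))                            ≡⟨ Σw-cong k (λ X _ → trans (Σw-const m (g X)) (*-comm (g X) (q ^ m))) ⟩
    Σw k (λ X → q ^ m * g X)                                 ≡⟨ Σw-*ˡ k (q ^ m) g ⟩
    q ^ m * Σw k g                                           ∎
    where
    F : Word q → ℕ
    F U = border k U * g (take k U)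
    matching : ∀ {k} X M → length X ≡ k →
               Σw k (λ Z → border k (X ++ M ++ Z) * g (take k (X ++ M ++ Z))) ≡ g X
    matching X M refl = trans
      (Σw-cong (length X) (λ Z ∣Z∣ → cong₂ _*_ (border-++ _ X M Z refl ∣Z∣) (cong g (take-++ _ X (M ++ Z) refl))))
      (Σw-pick X (λ _ → g X))

  split-2k : ∀ {k n} → k + k ≤ n → ∃ λ m → n ≡ k + (m + k) × n ∸ (k + k) ≡ m
  split-2k {k} 2k≤n with m≤n⇒∃[o]m+o≡n 2k≤n
  ... | m , refl = m , regroup k m , m+n∸m≡n (k + k) m
    where
    regroup : ∀ k m → k + k + m ≡ k + (m + k)
    regroup = solve-∀

  Σw-border : ∀ n k (g : Word q → ℕ) → k + k ≤ n →
               Σw n (λ U → border k U * g (take k U)) ≡ q ^ (n ∸ (k + k)) * Σw k g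
  Σw-border n k g 2k≤n with split-2k {k} 2k≤n
  ... | m , refl , n∸2k = trans (Σw-border-middle k m g) (cong (λ i → q ^ i * Σw k g) (sym n∸2k))

  Σw-bordered : ∀ n k → k + k ≤ n → Σw n (border k) ≡ q ^ (n ∸ k)
  Σw-bordered n k 2k≤n with split-2k {k} 2k≤n
  ... | m , refl , _ = begin
    Σw (k + (m + k)) (border k)                                ≡⟨ Σw-cong (k + (m + k)) (λ U _ → sym (*-identityʳ (border k U))) ⟩
    Σw (k + (m + k)) (λ U → border k U * 1)                    ≡⟨ Σw-border-middle k m (λ _ → 1) ⟩
    q ^ m * Σw k (λ _ → 1)                                     ≡⟨ cong (q ^ m *_) (trans (Σw-const k 1) (*-identityˡ (q ^ k))) ⟩
    q ^ m * q ^ k                                              ≡⟨ sym (^-distribˡ-+-* q m k) ⟩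
    q ^ (m + k)                                                ≡⟨ cong (q ^_) (sym (m+n∸m≡n k (m + k))) ⟩
    q ^ (k + (m + k) ∸ k)                                      ∎

module Bonferroni where

  open import Data.Nat
  open import Data.Nat.Properties
  open Indicator using (Bit; 0b; 1b)

  union-bound : ∀ {t x y} z → Bit x → Bit y → t ≤ 1 → t ≤ x + y + z → t + x * y ≤ x + y + z
  union-bound {t} z 0b 0b _   t≤z = ≤-trans (≤-reflexive (+-identityʳ t)) t≤z
  union-bound {t} z 0b 1b t≤1 _   = ≤-trans (≤-reflexive (+-identityʳ t)) (≤-trans t≤1 (m≤m+n 1 z))
  union-bound {t} z 1b 0b t≤1 _   = ≤-trans (≤-reflexive (+-identityʳ t)) (≤-trans t≤1 (m≤m+n 1 z))
  union-bound {t} z 1b 1b t≤1 _   = ≤-trans (+-monoˡ-≤ 1 t≤1) (m≤m+n 2 z)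

  three-bound : ∀ {x y z t} → Bit x → Bit y → Bit z → x ≤ t → y ≤ t → z ≤ t →
                x + y + z ≤ t + (y * x + z * (x ⊔ y))
  three-bound 0b 0b 0b _   _   _   = z≤n
  three-bound 1b 0b 0b x≤t _   _   = +-monoˡ-≤ 0 x≤t
  three-bound 0b 1b 0b _   y≤t _   = +-monoˡ-≤ 0 y≤t
  three-bound 0b 0b 1b _   _   z≤t = +-monoˡ-≤ 0 z≤t
  three-bound 1b 1b 0b x≤t _   _   = +-monoˡ-≤ 1 x≤t
  three-bound 1b 0b 1b x≤t _   _   = +-monoˡ-≤ 1 x≤t
  three-bound 0b 1b 1b _   y≤t _   = +-monoˡ-≤ 1 y≤t
  three-bound 1b 1b 1b x≤t _   _   = +-monoˡ-≤ 2 x≤t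

module InstanceCounts (q : ℕ) (dec : ∀ {q} (U : Word q) → Dec (IsInstance U)) where

  open import Defs using (count)
  open import Data.Nat
  open import Data.Nat.Properties
  open import Data.List using (length; take; _∷_; [])
  open import Data.List.Properties using (length-take)
  open import Data.Product using (_,_)
  open import Relation.Nullary using (yes; no)
  open import Relation.Nullary.Negation using (contradiction)
  open import Relation.Binary.PropositionalEquality
  open Indicator
  open Bonferroni
  open WordSums q
  open Borders q
  open BorderCounts q

  bit-border : ∀ k U → Bit (border k U)
  bit-border k U = bit (border≤1 k U)

  properBorder : ℕ → Word q → ℕ
  properBorder k U = 𝟙 (suc (k + k) ≤? length U) * border k U

  properBorders : ℕ → ℕ → Word q → ℕ
  properBorders k zero    U = 0
  properBorders k (suc J) U = properBorder k U + properBorders (suc k) J U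

  properBorder≤properBorders : ∀ J k K U → k ≤ K → K < k + J → properBorder K U ≤ properBorders k J U
  properBorder≤properBorders zero    k K U k≤K K<k+0 = contradiction (≤-trans (≤-reflexive (+-identityʳ k)) k≤K) (<⇒≱ K<k+0)
  properBorder≤properBorders (suc J) k K U k≤K K<k+J with k ≟ K
  ... | yes refl = m≤m+n _ _
  ... | no k≢K   = ≤-trans (properBorder≤properBorders J (suc k) K U (≤∧≢⇒< k≤K k≢K) (≤-trans K<k+J (≤-reflexive (+-suc k J))))
                           (m≤n+m _ (properBorder k U))

  Σw-properBorder : ∀ n k → Σw n (properBorder k) ≤ q ^ (n ∸ k)
  Σw-properBorder n k with suc (k + k) ≤? n
  ... | yes 2k<n = ≤-trans (Σw-mono n proper≤border) (≤-reflexive (Σw-bordered n k (<⇒≤ 2k<n)))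
    where
    proper≤border : ∀ U → length U ≡ n → properBorder k U ≤ border k U
    proper≤border U _ = ≤-trans (*-monoˡ-≤ (border k U) (𝟙≤1 (suc (k + k) ≤? length U))) (≤-reflexive (*-identityˡ (border k U)))
  ... | no 2k≮n = ≤-trans (≤-reflexive (trans (Σw-cong n no-proper) (Σw-const n 0))) z≤n
    where
    no-proper : ∀ U → length U ≡ n → properBorder k U ≡ 0
    no-proper U refl = cong (_* border k U) (𝟙-no 2k≮n (suc (k + k) ≤? length U))

  powSum : ℕ → ℕ
  powSum zero    = 0
  powSum (suc e) = q ^ suc e + powSum e

  powSum-closed : ∀ {s} → q ≡ suc s → ∀ e → s * powSum e + q ≡ q ^ suc e
  powSum-closed {s} q≡ zero    = trans (cong (_+ q) (*-zeroʳ s)) (sym (*-identityʳ q))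
  powSum-closed {s} q≡ (suc e) = begin
    s * (q ^ suc e + powSum e) + q    ≡⟨ cong (_+ q) (*-distribˡ-+ s (q ^ suc e) (powSum e)) ⟩
    s * q ^ suc e + s * powSum e + q  ≡⟨ +-assoc (s * q ^ suc e) _ _ ⟩
    s * q ^ suc e + (s * powSum e + q) ≡⟨ cong (s * q ^ suc e +_) (powSum-closed q≡ e) ⟩
    s * q ^ suc e + q ^ suc e          ≡⟨ +-comm (s * q ^ suc e) (q ^ suc e) ⟩
    suc s * q ^ suc e                  ≡⟨ cong (_* q ^ suc e) (sym q≡) ⟩
    q * q ^ suc e                      ∎
    where open ≡-Reasoning

  Σw-properBorders : ∀ J k {n} e → n ≡ k + e → J ≤ e → Σw n (properBorders k J) ≤ powSum e
  Σw-properBorders zero    k {n} e       _  _         = ≤-trans (≤-reflexive (Σw-const n 0)) z≤n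
  Σw-properBorders (suc J) k {n} (suc e) n≡ (s≤s J≤e) = begin
    Σw n (λ U → properBorder k U + properBorders (suc k) J U)  ≡⟨ Σw-+ n _ _ ⟩
    Σw n (properBorder k) + Σw n (properBorders (suc k) J)
      ≤⟨ +-mono-≤ (Σw-properBorder n k) (Σw-properBorders J (suc k) e (trans n≡ (+-suc k e)) J≤e) ⟩
    q ^ (n ∸ k) + powSum e  ≡⟨ cong (λ i → q ^ i + powSum e) (trans (cong (_∸ k) n≡) (m+n∸m≡n k (suc e))) ⟩
    powSum (suc e)          ∎
    where open ≤-Reasoning

  border-pair : ∀ {j k} U → j ≤ k → k ≤ length U →
                border k U * border j (take k U) ≡ border k U * border j U
  border-pair {j} {k} U j≤k k≤∣U∣ with take k U ≟ʷ suffix k U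
  ... | yes bordered = cong (1 *_) (border-nest U j≤k k≤∣U∣ bordered)
  ... | no _         = refl

  -- A word x₁x₂x₃ with border x₁x₂ = x₂x₃ is constant, hence has border x₁ = x₃.
  border₂≤border₁ : ∀ (X : Word q) → length X ≡ 3 → border 2 X ≤ border 1 X
  border₂≤border₁ (x₁ ∷ x₂ ∷ x₃ ∷ []) _ with x₁ ∷ x₂ ∷ [] ≟ʷ x₂ ∷ x₃ ∷ []
  ... | no _     = z≤n
  ... | yes refl = ≤-reflexive (sym (𝟙-yes refl (x₁ ∷ [] ≟ʷ x₁ ∷ [])))

  -- Pointwise upper bound: an instance has a border of length 1 or 2 or a
  -- proper border of length at least 3.
  instance-upper : ∀ n U → length U ≡ n →
    𝟙 (dec U) + border 1 U * border 2 U ≤ border 1 U + border 2 U + properBorders 3 (n ∸ 3) U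
  instance-upper n U ∣U∣ =
    union-bound (properBorders 3 (n ∸ 3) U) (bit-border 1 U) (bit-border 2 U) (𝟙≤1 (dec U)) covered
    where
    covered : 𝟙 (dec U) ≤ border 1 U + border 2 U + properBorders 3 (n ∸ 3) U
    covered with dec U
    ... | no _ = z≤n
    ... | yes inst with instance⇒bordered U inst
    ...   | zero , _ , bordered =
      ≤-trans (≤-reflexive (sym (𝟙-yes bordered (take 1 U ≟ʷ suffix 1 U)))) (≤-trans (m≤m+n _ _) (m≤m+n _ _))
    ...   | suc zero , _ , bordered =
      ≤-trans (≤-reflexive (sym (𝟙-yes bordered (take 2 U ≟ʷ suffix 2 U)))) (≤-trans (m≤n+m _ (border 1 U)) (m≤m+n _ _))
    ...   | suc (suc k) , 2K<∣U∣ , bordered = ≤-trans proper (m≤n+m _ _)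
      where
      K = suc (suc (suc k))
      isProper : properBorder K U ≡ 1
      isProper = cong₂ _*_ (𝟙-yes 2K<∣U∣ (suc (K + K) ≤? length U)) (𝟙-yes bordered (take K U ≟ʷ suffix K U))
      K<n : K < n
      K<n = ≤-trans (s≤s (m≤m+n K K)) (≤-trans 2K<∣U∣ (≤-reflexive ∣U∣))
      K<3+[n∸3] : K < 3 + (n ∸ 3)
      K<3+[n∸3] = ≤-trans K<n (≤-reflexive (sym (m+[n∸m]≡n (≤-trans (m≤m+n 3 k) (<⇒≤ K<n)))))
      proper : 1 ≤ properBorders 3 (n ∸ 3) U
      proper = ≤-trans (≤-reflexive (sym isProper)) (properBorder≤properBorders (n ∸ 3) 3 K U (m≤m+n 3 k) K<3+[n∸3])

  -- Pointwise lower bound (|U| ≥ 7): inclusion–exclusion for the borders of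
  -- lengths 1, 2, 3, each of which witnesses an instance.
  instance-lower : ∀ U → 7 ≤ length U →
    border 1 U + border 2 U + border 3 U ≤ 𝟙 (dec U) + (border 2 U * border 1 (take 2 U) + border 3 U * border 1 (take 3 U))
  instance-lower U 7≤∣U∣ = begin
    b₁ + b₂ + b₃                                         ≤⟨ three-bound (bit-border 1 U) (bit-border 2 U) (bit-border 3 U)
                                                                         (witness 0 (≤-trans (m≤m+n 3 4) 7≤∣U∣))
                                                                         (witness 1 (≤-trans (m≤m+n 5 2) 7≤∣U∣))
                                                                         (witness 2 7≤∣U∣) ⟩
    t + (b₂ * b₁ + b₃ * (b₁ ⊔ b₂))                       ≡⟨ cong (λ e → t + (e + b₃ * (b₁ ⊔ b₂))) (sym (border-pair U (s≤s z≤n) ≤2)) ⟩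
    t + (b₂ * border 1 (take 2 U) + b₃ * (b₁ ⊔ b₂))      ≤⟨ +-monoʳ-≤ t (+-monoʳ-≤ (b₂ * border 1 (take 2 U)) triple) ⟩
    t + (b₂ * border 1 (take 2 U) + b₃ * border 1 (take 3 U)) ∎
    where
    open ≤-Reasoning
    t = 𝟙 (dec U)
    b₁ = border 1 U
    b₂ = border 2 U
    b₃ = border 3 U
    ≤3 : 3 ≤ length U
    ≤3 = ≤-trans (m≤m+n 3 4) 7≤∣U∣
    ≤2 : 2 ≤ length U
    ≤2 = ≤-trans (m≤m+n 2 5) 7≤∣U∣
    witness : ∀ k → suc (suc k + suc k) ≤ length U → border (suc k) U ≤ t
    witness k 2k<∣U∣ with take (suc k) U ≟ʷ suffix (suc k) U
    ... | no _         = z≤n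
    ... | yes bordered = ≤-reflexive (sym (𝟙-yes (bordered⇒instance k U 2k<∣U∣ bordered) (dec U)))
    triple : b₃ * (b₁ ⊔ b₂) ≤ b₃ * border 1 (take 3 U)
    triple with take 3 U ≟ʷ suffix 3 U
    ... | no _         = z≤n
    ... | yes bordered = *-monoʳ-≤ 1 (⊔-lub
      (≤-reflexive (sym (border-nest U (s≤s z≤n) ≤3 bordered)))
      (≤-trans (≤-reflexive (sym (border-nest U (s≤s (s≤s z≤n)) ≤3 bordered)))
               (border₂≤border₁ (take 3 U) (trans (length-take 3 U) (m≤n⇒m⊓n≡m ≤3)))))

  -- Counts of words of length n = 7 + m with two borders, via their
  -- prefixes (P = q^(3+m) = q^(n-4)): a word with borders of lengths 2
  -- and 1 is determined by a constant prefix of length 2 and n - 4 free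
  -- letters, and similarly for lengths 3 and 1.
  Σw-pair₁₂ : ∀ m → Σw (7 + m) (λ U → border 2 U * border 1 (take 2 U)) ≡ q ^ (3 + m) * q
  Σw-pair₁₂ m = trans (Σw-border (7 + m) 2 (border 1) (m≤m+n 4 (3 + m)))
                      (cong (q ^ (3 + m) *_) (trans (Σw-bordered 2 1 ≤-refl) (*-identityʳ q)))

  Σw-pair₁₃ : ∀ m → Σw (7 + m) (λ U → border 3 U * border 1 (take 3 U)) ≡ q ^ (3 + m)
  Σw-pair₁₃ m = begin
    Σw (7 + m) (λ U → border 3 U * border 1 (take 3 U))  ≡⟨ Σw-border (7 + m) 3 (border 1) (m≤m+n 6 (1 + m)) ⟩
    q ^ (1 + m) * Σw 3 (border 1)                        ≡⟨ cong (q ^ (1 + m) *_) (Σw-bordered 3 1 (n≤1+n 2)) ⟩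
    q ^ (1 + m) * q ^ 2                                  ≡⟨ sym (^-distribˡ-+-* q (1 + m) 2) ⟩
    q ^ (1 + m + 2)                                      ≡⟨ cong (q ^_) (+-comm (1 + m) 2) ⟩
    q ^ (3 + m)                                          ∎
    where open ≡-Reasoning

  upperCount : ∀ m → let P = q ^ (3 + m) in
    count dec q (7 + m) + P * q ≤ q * (q * (q * P)) + q * (q * P) + powSum (4 + m)
  upperCount m = begin
    count dec q n + q ^ (3 + m) * q
      ≡⟨ cong₂ _+_ (count-Σw dec n) (sym (trans (Σw-cong n pair) (Σw-pair₁₂ m))) ⟩
    Σw n (λ U → 𝟙 (dec U)) + Σw n (λ U → border 1 U * border 2 U)
      ≡⟨ sym (Σw-+ n (λ U → 𝟙 (dec U)) (λ U → border 1 U * border 2 U)) ⟩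
    Σw n (λ U → 𝟙 (dec U) + border 1 U * border 2 U)
      ≤⟨ Σw-mono n (instance-upper n) ⟩
    Σw n (λ U → border 1 U + border 2 U + properBorders 3 (4 + m) U)
      ≡⟨ trans (Σw-+ n (λ U → border 1 U + border 2 U) (properBorders 3 (4 + m)))
               (cong (_+ Σw n (properBorders 3 (4 + m))) (Σw-+ n (border 1) (border 2))) ⟩
    Σw n (border 1) + Σw n (border 2) + Σw n (properBorders 3 (4 + m))
      ≤⟨ +-mono-≤ (≤-reflexive (cong₂ _+_ (Σw-bordered n 1 (m≤m+n 2 (5 + m))) (Σw-bordered n 2 (m≤m+n 4 (3 + m)))))
                  (Σw-properBorders (4 + m) 3 (4 + m) refl ≤-refl) ⟩
    q ^ (6 + m) + q ^ (5 + m) + powSum (4 + m)  ∎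
    where
    open ≤-Reasoning
    n = 7 + m
    pair : ∀ U → length U ≡ n → border 1 U * border 2 U ≡ border 2 U * border 1 (take 2 U)
    pair U ∣U∣ = trans (*-comm (border 1 U) (border 2 U))
                       (sym (border-pair U (s≤s z≤n) (≤-trans (m≤m+n 2 (5 + m)) (≤-reflexive (sym ∣U∣)))))

  lowerCount : ∀ m → let P = q ^ (3 + m) in
    q * (q * (q * P)) + q * (q * P) + q * P ≤ count dec q (7 + m) + (P * q + P)
  lowerCount m = begin
    q ^ (6 + m) + q ^ (5 + m) + q ^ (4 + m)
      ≡⟨ sym (cong₂ _+_ (cong₂ _+_ (Σw-bordered n 1 (m≤m+n 2 (5 + m))) (Σw-bordered n 2 (m≤m+n 4 (3 + m))))
                        (Σw-bordered n 3 (m≤m+n 6 (1 + m)))) ⟩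
    Σw n (border 1) + Σw n (border 2) + Σw n (border 3)
      ≡⟨ sym (trans (Σw-+ n (λ U → border 1 U + border 2 U) (border 3))
                    (cong (_+ Σw n (border 3)) (Σw-+ n (border 1) (border 2)))) ⟩
    Σw n (λ U → border 1 U + border 2 U + border 3 U)
      ≤⟨ Σw-mono n (λ U ∣U∣ → instance-lower U (≤-trans (m≤m+n 7 m) (≤-reflexive (sym ∣U∣)))) ⟩
    Σw n (λ U → 𝟙 (dec U) + (pair₁₂ U + pair₁₃ U))
      ≡⟨ trans (Σw-+ n (λ U → 𝟙 (dec U)) (λ U → pair₁₂ U + pair₁₃ U))
               (cong (Σw n (λ U → 𝟙 (dec U)) +_) (Σw-+ n pair₁₂ pair₁₃)) ⟩
    Σw n (λ U → 𝟙 (dec U)) + (Σw n pair₁₂ + Σw n pair₁₃)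
      ≡⟨ cong₂ _+_ (sym (count-Σw dec n)) (cong₂ _+_ (Σw-pair₁₂ m) (Σw-pair₁₃ m)) ⟩
    count dec q n + (q ^ (3 + m) * q + q ^ (3 + m))  ∎
    where
    open ≤-Reasoning
    n = 7 + m
    pair₁₂ pair₁₃ : Word q → ℕ
    pair₁₂ U = border 2 U * border 1 (take 2 U)
    pair₁₃ U = border 3 U * border 1 (take 3 U)

module Fractions where

  open import Data.Nat as ℕ using (suc; NonZero)
  import Data.Nat.Properties as ℕP
  open import Data.Integer as ℤ using (+_)
  import Data.Integer.Properties as ℤP
  open import Data.Rational using (ℚ; _/_; toℚᵘ; _+_; _-_; _*_; _<_; _≤_; ∣_∣)
  import Data.Rational.Properties as ℚP
  import Data.Rational.Unnormalised as ℚᵘ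
  import Data.Rational.Unnormalised.Properties as ℚᵘP
  open import Relation.Binary.PropositionalEquality

  frac : (a b : ℕ) .{{_ : NonZero b}} → ℚ
  frac a b = (+ a) / b

  private
    toℚᵘ-frac : ∀ a b .{{_ : NonZero b}} → toℚᵘ (frac a b) ℚᵘ.≃ ℚᵘ.mkℚᵘ (+ a) (ℕ.pred b)
    toℚᵘ-frac a (suc b) = ℚP.toℚᵘ-fromℚᵘ (ℚᵘ.mkℚᵘ (+ a) b)

    via-ℚᵘ : ∀ {x y} {u : ℚᵘ.ℚᵘ} → toℚᵘ x ℚᵘ.≃ u → u ℚᵘ.≃ toℚᵘ y → x ≡ y
    via-ℚᵘ x≃u u≃y = ℚP.toℚᵘ-injective (ℚᵘP.≃-trans x≃u u≃y)

  frac-+ : ∀ a b c d .{{_ : NonZero b}} .{{_ : NonZero d}} →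
           frac a b + frac c d ≡ (frac (a ℕ.* d ℕ.+ c ℕ.* b) (b ℕ.* d)) {{ℕP.m*n≢0 b d}}
  frac-+ a b@(suc _) c d@(suc _) = via-ℚᵘ
    (ℚᵘP.≃-trans (ℚP.toℚᵘ-homo-+ (frac a b) (frac c d)) (ℚᵘP.+-cong (toℚᵘ-frac a b) (toℚᵘ-frac c d)))
    (ℚᵘP.≃-trans (ℚᵘP.≃-reflexive numerator) (ℚᵘP.≃-sym (toℚᵘ-frac _ (b ℕ.* d))))
    where
    numerator : ℚᵘ.mkℚᵘ (+ a) (ℕ.pred b) ℚᵘ.+ ℚᵘ.mkℚᵘ (+ c) (ℕ.pred d)
              ≡ ℚᵘ.mkℚᵘ (+ (a ℕ.* d ℕ.+ c ℕ.* b)) (ℕ.pred (b ℕ.* d))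
    numerator = cong (λ z → ℚᵘ.mkℚᵘ z (ℕ.pred (b ℕ.* d)))
      (trans (cong₂ ℤ._+_ (sym (ℤP.pos-* a d)) (sym (ℤP.pos-* c b))) (sym (ℤP.pos-+ (a ℕ.* d) (c ℕ.* b))))

  frac-* : ∀ a b c d .{{_ : NonZero b}} .{{_ : NonZero d}} →
           frac a b * frac c d ≡ (frac (a ℕ.* c) (b ℕ.* d)) {{ℕP.m*n≢0 b d}}
  frac-* a b@(suc _) c d@(suc _) = via-ℚᵘ
    (ℚᵘP.≃-trans (ℚP.toℚᵘ-homo-* (frac a b) (frac c d)) (ℚᵘP.*-cong (toℚᵘ-frac a b) (toℚᵘ-frac c d)))
    (ℚᵘP.≃-trans (ℚᵘP.≃-reflexive numerator) (ℚᵘP.≃-sym (toℚᵘ-frac _ (b ℕ.* d))))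
    where
    numerator : ℚᵘ.mkℚᵘ (+ a) (ℕ.pred b) ℚᵘ.* ℚᵘ.mkℚᵘ (+ c) (ℕ.pred d)
              ≡ ℚᵘ.mkℚᵘ (+ (a ℕ.* c)) (ℕ.pred (b ℕ.* d))
    numerator = cong (λ z → ℚᵘ.mkℚᵘ z (ℕ.pred (b ℕ.* d))) (sym (ℤP.pos-* a c))

  frac-- : ∀ a b c d e .{{_ : NonZero b}} .{{_ : NonZero d}} → c ℕ.* b ℕ.+ e ≡ a ℕ.* d →
           frac a b - frac c d ≡ (frac e (b ℕ.* d)) {{ℕP.m*n≢0 b d}}
  frac-- a b@(suc _) c d@(suc _) e ad≡cb+e = via-ℚᵘ
    (ℚᵘP.≃-trans (ℚP.toℚᵘ-homo-+ (frac a b) (ℚ.-_ (frac c d)))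
                 (ℚᵘP.+-cong (toℚᵘ-frac a b) (ℚᵘP.≃-trans (ℚP.toℚᵘ-homo‿- (frac c d)) (ℚᵘP.-‿cong (toℚᵘ-frac c d)))))
    (ℚᵘP.≃-trans (ℚᵘP.≃-reflexive numerator) (ℚᵘP.≃-sym (toℚᵘ-frac _ (b ℕ.* d))))
    where
    import Data.Rational as ℚ
    numerator : ℚᵘ.mkℚᵘ (+ a) (ℕ.pred b) ℚᵘ.+ ℚᵘ.- ℚᵘ.mkℚᵘ (+ c) (ℕ.pred d)
              ≡ ℚᵘ.mkℚᵘ (+ e) (ℕ.pred (b ℕ.* d))
    numerator = cong (λ z → ℚᵘ.mkℚᵘ z (ℕ.pred (b ℕ.* d))) (begin
      + a ℤ.* + d ℤ.+ ℤ.- (+ c) ℤ.* + b   ≡⟨ cong₂ ℤ._+_ (sym (ℤP.pos-* a d)) (sym (ℤP.neg-distribˡ-* (+ c) (+ b))) ⟩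
      + (a ℕ.* d) ℤ.+ ℤ.- (+ c ℤ.* + b)   ≡⟨ cong (λ z → + (a ℕ.* d) ℤ.+ ℤ.- z) (sym (ℤP.pos-* c b)) ⟩
      + (a ℕ.* d) ℤ.- + (c ℕ.* b)         ≡⟨ ℤP.m-n≡m⊖n (a ℕ.* d) (c ℕ.* b) ⟩
      (a ℕ.* d) ℤ.⊖ (c ℕ.* b)             ≡⟨ ℤP.⊖-≥ (ℕP.≤-trans (ℕP.m≤m+n _ e) (ℕP.≤-reflexive ad≡cb+e)) ⟩
      + (a ℕ.* d ℕ.∸ c ℕ.* b)             ≡⟨ cong (λ z → + (z ℕ.∸ c ℕ.* b)) (sym ad≡cb+e) ⟩
      + (c ℕ.* b ℕ.+ e ℕ.∸ c ℕ.* b)       ≡⟨ cong +_ (ℕP.m+n∸m≡n (c ℕ.* b) e) ⟩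
      + e                                 ∎)
      where open ≡-Reasoning

  frac-< : ∀ a b c d .{{_ : NonZero b}} .{{_ : NonZero d}} → a ℕ.* d ℕ.< c ℕ.* b → frac a b < frac c d
  frac-< a b@(suc _) c d@(suc _) ad<cb = ℚP.toℚᵘ-cancel-<
    (ℚᵘP.<-respˡ-≃ (ℚᵘP.≃-sym (toℚᵘ-frac a b)) (ℚᵘP.<-respʳ-≃ (ℚᵘP.≃-sym (toℚᵘ-frac c d))
      (ℚᵘ.*<* (subst₂ ℤ._<_ (ℤP.pos-* a d) (ℤP.pos-* c b) (ℤ.+<+ ad<cb)))))

  frac-≤ : ∀ a b c d .{{_ : NonZero b}} .{{_ : NonZero d}} → a ℕ.* d ℕ.≤ c ℕ.* b → frac a b ≤ frac c d
  frac-≤ a b@(suc _) c d@(suc _) ad≤cb = ℚP.toℚᵘ-cancel-≤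
    (ℚᵘP.≤-respˡ-≃ (ℚᵘP.≃-sym (toℚᵘ-frac a b)) (ℚᵘP.≤-respʳ-≃ (ℚᵘP.≃-sym (toℚᵘ-frac c d))
      (ℚᵘ.*≤* (subst₂ ℤ._≤_ (ℤP.pos-* a d) (ℤP.pos-* c b) (ℤ.+≤+ ad≤cb)))))

  ∣frac∣ : ∀ a b .{{_ : NonZero b}} → ∣ frac a b ∣ ≡ frac a b
  ∣frac∣ a b@(suc _) = ℚP.0≤p⇒∣p∣≡p (frac-≤ 0 1 a b ℕ.z≤n)

-- Here q = r + 2 is
-- the alphabet size, s = q - 1, P = q^(n-4), D = qⁿ = q⁴P, c is the number
-- of instances of length n and G = q + ⋯ + q^(n-3).
module Estimates (r : ℕ) where

  open import Data.Nat
  open import Data.Nat.Properties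
  open import Data.Nat.Tactic.RingSolver using (solve-∀)
  open import Relation.Binary.PropositionalEquality

  q s : ℕ
  q = suc (suc r)
  s = suc r

  instance
    q⁴-nonZero : NonZero (q ^ 4)
    q⁴-nonZero = m^n≢0 q 4

  private
    split-lower : ∀ r P → (2 + r) * ((2 + r) * ((2 + r) * P)) + (2 + r) * ((2 + r) * P) + (2 + r) * P
                        ≡ ((2 + r) * ((2 + r) * (2 + r)) + 1) * P + P + (P * (2 + r) + P) + (1 + 4 * r + r * r) * P
    split-lower = solve-∀

    q⁴-upper : ∀ r P → (1 + r) * ((2 + r) * ((2 + r) * ((2 + r) * P)) + (2 + r) * ((2 + r) * P)) + (2 + r) * ((2 + r) * P)
                     ≡ (2 + r) * ((2 + r) * ((2 + r) * ((2 + r) * P)))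
    q⁴-upper = solve-∀

    q⁴-lower : ∀ r P → (2 + r) * ((2 + r) * ((2 + r) * ((2 + r) * P)))
                     ≡ (1 + r) * ((2 + r) * ((2 + r) * ((2 + r) * P)) + (2 + r) * ((2 + r) * P) + (2 + r) * P) + (2 + r) * P
    q⁴-lower = solve-∀

    regroup-lower : ∀ r P c → (1 + r) * (c + (P * (2 + r) + P)) + (2 + r) * P
                            ≡ (1 + r) * c + (1 + r) * ((2 + r) * P) + (2 * (1 + r) + 1) * P
    regroup-lower = solve-∀

    regroup-upper : ∀ s c P q G → s * c + s * (q * P) + q ≡ s * (c + P * q) + q
    regroup-upper = solve-∀

    distrib-upper : ∀ s A B G q → s * (A + B + G) + q ≡ s * (A + B) + (s * G + q)
    distrib-upper = solve-∀

    lower-goal : ∀ r P → (1 * ((2 + r) * ((2 + r) * ((2 + r) * ((2 + r) * 1)))) + 1 * (2 + r))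
                           * ((2 + r) * ((2 + r) * ((2 + r) * ((2 + r) * P))))
                       ≡ ((2 + r) * ((2 + r) * ((2 + r) * ((2 + r) * ((2 + r) * 1)))))
                           * (((2 + r) * ((2 + r) * (2 + r)) + 1) * P)
    lower-goal = solve-∀

    upper-goal : ∀ r P c → (c * ((2 + r) * ((2 + r) * ((2 + r) * ((2 + r) * 1))))
                             + 1 * ((2 + r) * ((2 + r) * ((2 + r) * ((2 + r) * P))))) * (1 + r)
                         ≡ ((2 + r) * ((2 + r) * ((2 + r) * ((2 + r) * 1)))) * ((1 + r) * c + (1 + r) * P)
    upper-goal = solve-∀

    s·D≡q³·sqP : ∀ r P → (1 + r) * ((2 + r) * ((2 + r) * ((2 + r) * ((2 + r) * P))))
                       ≡ ((2 + r) * ((2 + r) * ((2 + r) * 1))) * ((1 + r) * ((2 + r) * P))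
    s·D≡q³·sqP = solve-∀

    q³·gap : ∀ r P a → ((2 + r) * ((2 + r) * ((2 + r) * 1))) * ((1 + r) * ((2 + r) * P) + a)
                     ≡ (1 + r) * ((2 + r) * ((2 + r) * ((2 + r) * ((2 + r) * P))))
                       + ((2 + r) * ((2 + r) * ((2 + r) * 1))) * a
    q³·gap = solve-∀

    reassociate : ∀ a b P d → a * (b * P) * d ≡ a * P * (b * d)
    reassociate = solve-∀

    q³P·sq≡s·D : ∀ r P → ((2 + r) * ((2 + r) * ((2 + r) * 1))) * P * ((1 + r) * (2 + r))
                       ≡ (1 + r) * ((2 + r) * ((2 + r) * ((2 + r) * ((2 + r) * P))))
    q³P·sq≡s·D = solve-∀

    double : ∀ r d → (2 * (1 + r) + 1) * suc d + suc d ≡ 2 * suc d * (2 + r)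
    double = solve-∀

  module Bounds (P c G : ℕ) (1≤P : 1 ≤ P)
    (lower : q * (q * (q * P)) + q * (q * P) + q * P ≤ c + (P * q + P))
    (upper : c + P * q ≤ q * (q * (q * P)) + q * (q * P) + G)
    (geom  : s * G + q ≡ q * (q * P)) where

    open ≤-Reasoning

    D : ℕ
    D = q * (q * (q * (q * P)))

    D>0 : 0 < D
    D>0 = ≤-trans 1≤P (≤-trans (m≤n*m P q) (≤-trans (m≤n*m (q * P) q)
                       (≤-trans (m≤n*m (q * (q * P)) q) (m≤n*m (q * (q * (q * P))) q))))

    lower-margin : (q * (q * q) + 1) * P < c
    lower-margin = begin-strict
      (q * (q * q) + 1) * P      <⟨ m<m+n _ 1≤P ⟩
      (q * (q * q) + 1) * P + P  ≤⟨ +-cancelʳ-≤ (P * q + P) _ _ (begin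
        (q * (q * q) + 1) * P + P + (P * q + P)                            ≤⟨ m≤m+n _ _ ⟩
        (q * (q * q) + 1) * P + P + (P * q + P) + (1 + 4 * r + r * r) * P  ≡⟨ sym (split-lower r P) ⟩
        q * (q * (q * P)) + q * (q * P) + q * P                            ≤⟨ lower ⟩
        c + (P * q + P)                                                    ∎) ⟩
      c                          ∎

    lower-scaled : D ≤ s * c + s * (q * P) + (2 * s + 1) * P
    lower-scaled = begin
      D                                                          ≡⟨ q⁴-lower r P ⟩
      s * (q * (q * (q * P)) + q * (q * P) + q * P) + q * P      ≤⟨ +-monoˡ-≤ (q * P) (*-monoʳ-≤ s lower) ⟩
      s * (c + (P * q + P)) + q * P                              ≡⟨ regroup-lower r P c ⟩
      s * c + s * (q * P) + (2 * s + 1) * P                      ∎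

    upper-scaled : s * c + s * (q * P) + q ≤ D
    upper-scaled = begin
      s * c + s * (q * P) + q                                  ≡⟨ regroup-upper s c P q G ⟩
      s * (c + P * q) + q                                      ≤⟨ +-monoˡ-≤ q (*-monoʳ-≤ s upper) ⟩
      s * (q * (q * (q * P)) + q * (q * P) + G) + q            ≡⟨ distrib-upper s (q * (q * (q * P))) (q * (q * P)) G q ⟩
      s * (q * (q * (q * P)) + q * (q * P)) + (s * G + q)      ≡⟨ cong (s * (q * (q * (q * P)) + q * (q * P)) +_) geom ⟩
      s * (q * (q * (q * P)) + q * (q * P)) + q * (q * P)      ≡⟨ q⁴-upper r P ⟩
      D                                                        ∎

    -- 1/q + 1/q⁴ < c/qⁿ, cross-multiplied.
    lower-frac : (1 * q ^ 4 + 1 * q) * D < c * (q * q ^ 4)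
    lower-frac = begin-strict
      (1 * q ^ 4 + 1 * q) * D                 ≡⟨ lower-goal r P ⟩
      (q * q ^ 4) * ((q * (q * q) + 1) * P)   <⟨ *-monoʳ-< (q * q ^ 4) {{m*n≢0 q (q ^ 4)}} lower-margin ⟩
      (q * q ^ 4) * c                         ≡⟨ *-comm (q * q ^ 4) c ⟩
      c * (q * q ^ 4)                         ∎

    -- c/qⁿ + 1/q⁴ < 1/s, cross-multiplied.
    upper-frac : (c * q ^ 4 + 1 * D) * s < 1 * (D * q ^ 4)
    upper-frac = begin-strict
      (c * q ^ 4 + 1 * D) * s    ≡⟨ upper-goal r P c ⟩
      q ^ 4 * (s * c + s * P)    <⟨ *-monoʳ-< (q ^ 4) s[c+P]<D ⟩
      q ^ 4 * D                  ≡⟨ trans (*-comm (q ^ 4) D) (sym (*-identityˡ (D * q ^ 4))) ⟩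
      1 * (D * q ^ 4)            ∎
      where
      s[c+P]<D : s * c + s * P < D
      s[c+P]<D = begin-strict
        s * c + s * P              ≤⟨ +-monoʳ-≤ (s * c) (*-monoʳ-≤ s (m≤n*m P q)) ⟩
        s * c + s * (q * P)        <⟨ m<m+n _ (s≤s z≤n) ⟩
        s * c + s * (q * P) + q    ≤⟨ upper-scaled ⟩
        D                          ∎

    -- The gap 1/s - c/qⁿ is e/(s qⁿ) with e = qⁿ - sc.
    gap-exists : c * s ≤ 1 * D
    gap-exists = begin
      c * s                      ≡⟨ *-comm c s ⟩
      s * c                      ≤⟨ ≤-trans (m≤m+n (s * c) (s * (q * P))) (m≤m+n _ q) ⟩
      s * c + s * (q * P) + q    ≤⟨ upper-scaled ⟩
      D                          ≡⟨ sym (*-identityˡ D) ⟩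
      1 * D                      ∎

    module Gap (e : ℕ) (c·s+e≡D : c * s + e ≡ 1 * D) where

      s·c+e≡D : s * c + e ≡ D
      s·c+e≡D = trans (cong (_+ e) (*-comm s c)) (trans c·s+e≡D (*-identityˡ D))

      gap-lower : s * (q * P) ≤ e
      gap-lower = +-cancelˡ-≤ (s * c) _ _ (begin
        s * c + s * (q * P)        ≤⟨ m≤m+n _ q ⟩
        s * c + s * (q * P) + q    ≤⟨ upper-scaled ⟩
        D                          ≡⟨ sym s·c+e≡D ⟩
        s * c + e                  ∎)

      gap-upper : e ≤ s * (q * P) + (2 * s + 1) * P
      gap-upper = +-cancelˡ-≤ (s * c) _ _ (begin
        s * c + e                                      ≡⟨ s·c+e≡D ⟩
        D                                              ≤⟨ lower-scaled ⟩
        s * c + s * (q * P) + (2 * s + 1) * P          ≡⟨ +-assoc (s * c) _ _ ⟩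
        s * c + (s * (q * P) + (2 * s + 1) * P)        ∎)

      -- q³(1/s - c/qⁿ) - 1 = w/(s qⁿ) with w = q³e - s qⁿ.
      error-exists : 1 * (1 * (s * D)) ≤ q ^ 3 * e * 1
      error-exists = begin
        1 * (1 * (s * D))        ≡⟨ trans (*-identityˡ _) (*-identityˡ _) ⟩
        s * D                    ≡⟨ s·D≡q³·sqP r P ⟩
        q ^ 3 * (s * (q * P))    ≤⟨ *-monoʳ-≤ (q ^ 3) gap-lower ⟩
        q ^ 3 * e                ≡⟨ sym (*-identityʳ _) ⟩
        q ^ 3 * e * 1            ∎

      module Error (w : ℕ) (s·D+w≡q³e : 1 * (1 * (s * D)) + w ≡ q ^ 3 * e * 1) where

        error-upper : w ≤ q ^ 3 * ((2 * s + 1) * P)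
        error-upper = +-cancelˡ-≤ (s * D) _ _ (begin
          s * D + w                                          ≡⟨ trans (cong (_+ w) (sym (trans (*-identityˡ _) (*-identityˡ _))))
                                                                      (trans s·D+w≡q³e (*-identityʳ _)) ⟩
          q ^ 3 * e                                          ≤⟨ *-monoʳ-≤ (q ^ 3) gap-upper ⟩
          q ^ 3 * (s * (q * P) + (2 * s + 1) * P)            ≡⟨ q³·gap r P ((2 * s + 1) * P) ⟩
          s * D + q ^ 3 * ((2 * s + 1) * P)                  ∎)

        -- w/(s qⁿ) < (k+1)/(d+1) as soon as s ≥ 2(d + 1).
        error-small : ∀ k d → 2 * suc d ≤ s → w * suc d < suc k * (1 * (s * D) * 1)
        error-small k d 2[d+1]≤s = begin-strict
          w * suc d                               ≤⟨ *-monoˡ-≤ (suc d) error-upper ⟩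
          q ^ 3 * ((2 * s + 1) * P) * suc d       ≡⟨ reassociate (q ^ 3) (2 * s + 1) P (suc d) ⟩
          q ^ 3 * P * ((2 * s + 1) * suc d)       <⟨ *-monoʳ-< (q ^ 3 * P) {{m*n≢0 (q ^ 3) P {{m^n≢0 q 3}} {{>-nonZero 1≤P}}}} small ⟩
          q ^ 3 * P * (s * q)                     ≡⟨ q³P·sq≡s·D r P ⟩
          s * D                                   ≡⟨ sym (trans (*-identityʳ _) (*-identityˡ _)) ⟩
          1 * (s * D) * 1                         ≤⟨ m≤m+n _ _ ⟩
          suc k * (1 * (s * D) * 1)               ∎
          where
          small : (2 * s + 1) * suc d < s * q
          small = begin-strict
            (2 * s + 1) * suc d             <⟨ m<m+n _ (s≤s z≤n) ⟩
            (2 * s + 1) * suc d + suc d     ≡⟨ double r d ⟩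
            2 * suc d * q                   ≤⟨ *-monoˡ-≤ q 2[d+1]≤s ⟩
            s * q                           ∎

open import Defs
open import Data.Nat using (ℕ; _≤_; _∸_; _^_)
open import Data.Rational using (ℚ; 0ℚ; 1ℚ; _<_; _+_; _-_; _*_; ∣_∣; _/_)
open import Data.Integer using (+_)
open import Data.Product using (∃; _×_)
open import Relation.Nullary using (Dec)

import Data.Nat as ℕ
import Data.Nat.Properties as ℕP
import Data.Integer as ℤ
import Data.Integer.Properties as ℤP
import Data.Rational as ℚ
import Data.Rational.Properties as ℚP
open import Data.Product using (∃₂; _,_)
open import Relation.Binary.PropositionalEquality
open import Relation.Nullary.Negation using (contradiction)
open Fractions

module RationalEstimates (r : ℕ) where

  open Estimates r

  δ : ℚ
  δ = frac 1 (q ^ 4)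

  δ>0 : 0ℚ < δ
  δ>0 = frac-< 0 1 1 (q ^ 4) (ℕ.s≤s ℕ.z≤n)

  module ForCount (P c G : ℕ) (1≤P : 1 ≤ P)
    (lower : q ℕ.* (q ℕ.* (q ℕ.* P)) ℕ.+ q ℕ.* (q ℕ.* P) ℕ.+ q ℕ.* P ≤ c ℕ.+ (P ℕ.* q ℕ.+ P))
    (upper : c ℕ.+ P ℕ.* q ≤ q ℕ.* (q ℕ.* (q ℕ.* P)) ℕ.+ q ℕ.* (q ℕ.* P) ℕ.+ G)
    (geom  : s ℕ.* G ℕ.+ q ≡ q ℕ.* (q ℕ.* P)) where

    open Bounds P c G 1≤P lower upper geom

    instance
      D-nonZero : ℕ.NonZero D
      D-nonZero = ℕ.>-nonZero D>0

    above-1/q : frac 1 q + δ < frac c D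
    above-1/q = subst (_< frac c D) (sym (frac-+ 1 q 1 (q ^ 4)))
                      (frac-< (1 ℕ.* q ^ 4 ℕ.+ 1 ℕ.* q) (q ℕ.* q ^ 4) c D {{ℕP.m*n≢0 q (q ^ 4)}} lower-frac)

    below-1/s : frac c D + δ < frac 1 s
    below-1/s = subst (_< frac 1 s) (sym (frac-+ c D 1 (q ^ 4)))
                      (frac-< (c ℕ.* q ^ 4 ℕ.+ 1 ℕ.* D) (D ℕ.* q ^ 4) 1 s {{ℕP.m*n≢0 D (q ^ 4)}} upper-frac)

    -- |q³(1/s - c/D) - 1| < (k + 1)/(d + 1) when s ≥ 2(d + 1): writing
    -- 1/s - c/D = e/(sD), the error is w/(sD) with w = q³e - sD.
    close-to-1/s : ∀ k d → 2 ℕ.* ℕ.suc d ≤ s →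
      ∣ frac (q ^ 3) 1 * (frac 1 s - frac c D) - 1ℚ ∣ < frac (ℕ.suc k) (ℕ.suc d)
    close-to-1/s k d 2[d+1]≤s = via-gap (ℕP.m≤n⇒∃[o]m+o≡n gap-exists)
      where
      sD : ℕ
      sD = s ℕ.* D
      instance
        sD-nonZero : ℕ.NonZero sD
        sD-nonZero = ℕP.m*n≢0 s D
        1·sD-nonZero : ℕ.NonZero (1 ℕ.* sD)
        1·sD-nonZero = ℕP.m*n≢0 1 sD
        1·sD·1-nonZero : ℕ.NonZero (1 ℕ.* sD ℕ.* 1)
        1·sD·1-nonZero = ℕP.m*n≢0 (1 ℕ.* sD) 1

      via-error : ∀ e (c·s+e≡D : c ℕ.* s ℕ.+ e ≡ 1 ℕ.* D) →
                  ∃ (λ w → 1 ℕ.* (1 ℕ.* sD) ℕ.+ w ≡ q ^ 3 ℕ.* e ℕ.* 1) →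
                  ∣ frac (q ^ 3) 1 * (frac 1 s - frac c D) - 1ℚ ∣ < frac (ℕ.suc k) (ℕ.suc d)
      via-error e c·s+e≡D (w , s·D+w≡q³e) = begin-strict
        ∣ frac (q ^ 3) 1 * (frac 1 s - frac c D) - 1ℚ ∣  ≡⟨ cong (λ x → ∣ frac (q ^ 3) 1 * x - 1ℚ ∣) (frac-- 1 s c D e c·s+e≡D) ⟩
        ∣ frac (q ^ 3) 1 * frac e sD - 1ℚ ∣              ≡⟨ cong (λ x → ∣ x - 1ℚ ∣) (frac-* (q ^ 3) 1 e sD) ⟩
        ∣ frac (q ^ 3 ℕ.* e) (1 ℕ.* sD) - frac 1 1 ∣     ≡⟨ cong ∣_∣ (frac-- (q ^ 3 ℕ.* e) (1 ℕ.* sD) 1 1 w s·D+w≡q³e) ⟩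
        ∣ frac w (1 ℕ.* sD ℕ.* 1) ∣                      ≡⟨ ∣frac∣ w (1 ℕ.* sD ℕ.* 1) ⟩
        frac w (1 ℕ.* sD ℕ.* 1)                          <⟨ frac-< w (1 ℕ.* sD ℕ.* 1) (ℕ.suc k) (ℕ.suc d)
                                                              (Gap.Error.error-small e c·s+e≡D w s·D+w≡q³e k d 2[d+1]≤s) ⟩
        frac (ℕ.suc k) (ℕ.suc d)                         ∎
        where open ℚP.≤-Reasoning

      via-gap : ∃ (λ e → c ℕ.* s ℕ.+ e ≡ 1 ℕ.* D) →
                ∣ frac (q ^ 3) 1 * (frac 1 s - frac c D) - 1ℚ ∣ < frac (ℕ.suc k) (ℕ.suc d)
      via-gap (e , c·s+e≡D) = via-error e c·s+e≡D (ℕP.m≤n⇒∃[o]m+o≡n (Gap.error-exists e c·s+e≡D))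

module InstanceProbability (dec : ∀ {q} (U : Word q) → Dec (IsInstance U)) (r m : ℕ) where

  open Estimates r using (q; s)
  open InstanceCounts q dec using (powSum; powSum-closed; lowerCount; upperCount)
  open RationalEstimates r using (δ)
  private
    module Counted = RationalEstimates.ForCount r (q ^ (3 ℕ.+ m)) (count dec q (7 ℕ.+ m)) (powSum (4 ℕ.+ m))
      (ℕP.m^n>0 q (3 ℕ.+ m)) (lowerCount m) (upperCount m) (powSum-closed refl (4 ℕ.+ m))

  above-1/q : inv q + δ < Iₙ dec q (7 ℕ.+ m)
  above-1/q = Counted.above-1/q

  below-1/s : Iₙ dec q (7 ℕ.+ m) + δ < inv s
  below-1/s = Counted.below-1/s

  close-to-1/s : ∀ k d → 2 ℕ.* ℕ.suc d ≤ s →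
    ∣ frac (q ^ 3) 1 * (inv s - Iₙ dec q (7 ℕ.+ m)) - 1ℚ ∣ < frac (ℕ.suc k) (ℕ.suc d)
  close-to-1/s = Counted.close-to-1/s

from-7 : {Φ : ℕ → Set} → (∀ m → Φ (7 ℕ.+ m)) → ∀ n → 7 ≤ n → Φ n
from-7 Φ-7+m n 7≤n with ℕP.m≤n⇒∃[o]m+o≡n 7≤n
... | m , refl = Φ-7+m m

positive-fraction : ∀ ε → 0ℚ < ε → ∃₂ λ k d → ε ≡ frac (ℕ.suc k) (ℕ.suc d)
positive-fraction (ℚ.mkℚ (ℤ.+ ℕ.suc k) d _) _             = k , d , sym (ℚP.↥p/↧p≡p _)
positive-fraction (ℚ.mkℚ (ℤ.+ ℕ.zero) d _)  (ℚ.*<* 0<0)   = contradiction 0<0 (ℤP.<-irrefl refl)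
positive-fraction (ℚ.mkℚ ℤ.-[1+ _ ] d _)    (ℚ.*<* ())

strict-bounds : (dec : ∀ {q} (U : Word q) → Dec (IsInstance U)) → ∀ (q : ℕ) → 2 ≤ q →
    (∃ λ (δ : ℚ) → 0ℚ < δ × ∃ λ (N : ℕ) → ∀ (n : ℕ) → N ≤ n → inv q + δ < Iₙ dec q n)
  × (∃ λ (δ : ℚ) → 0ℚ < δ × ∃ λ (N : ℕ) → ∀ (n : ℕ) → N ≤ n → Iₙ dec q n + δ < inv (q ∸ 1))
strict-bounds dec (ℕ.suc ℕ.zero)    (ℕ.s≤s ())
strict-bounds dec (ℕ.suc (ℕ.suc r)) _ =
    (δ r , δ>0 r , 7 , from-7 (above-1/q dec r))
  , (δ r , δ>0 r , 7 , from-7 (below-1/s dec r))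
  where
  open RationalEstimates using (δ; δ>0)
  open InstanceProbability using (above-1/q; below-1/s)

asymptotics : (dec : ∀ {q} (U : Word q) → Dec (IsInstance U)) → ∀ (ε : ℚ) → 0ℚ < ε →
  ∃ λ (Q : ℕ) → ∀ (q : ℕ) → Q ≤ q → ∃ λ (N : ℕ) → ∀ (n : ℕ) → N ≤ n →
    ∣ ((+ (q ^ 3)) / 1) * (inv (q ∸ 1) - Iₙ dec q n) - 1ℚ ∣ < ε
asymptotics dec ε ε>0 with positive-fraction ε ε>0
... | k , d , refl = ℕ.suc (2 ℕ.* ℕ.suc d) , eventually-close
  where
  eventually-close : ∀ q → ℕ.suc (2 ℕ.* ℕ.suc d) ≤ q → ∃ λ (N : ℕ) → ∀ (n : ℕ) → N ≤ n →
    ∣ ((+ (q ^ 3)) / 1) * (inv (q ∸ 1) - Iₙ dec q n) - 1ℚ ∣ < frac (ℕ.suc k) (ℕ.suc d)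
  eventually-close (ℕ.suc ℕ.zero)    (ℕ.s≤s ())
  eventually-close (ℕ.suc (ℕ.suc r)) (ℕ.s≤s 2[d+1]≤s) =
    7 , from-7 (λ m → InstanceProbability.close-to-1/s dec r m k d 2[d+1]≤s)

corollary3p5 : (dec : ∀ {q} (U : Word q) → Dec (IsInstance U)) →
    (∀ (q : ℕ) → 2 ≤ q →
      (∃ λ (δ : ℚ) → 0ℚ < δ × ∃ λ (N : ℕ) → ∀ (n : ℕ) → N ≤ n →
          inv q + δ < Iₙ dec q n)
      × (∃ λ (δ : ℚ) → 0ℚ < δ × ∃ λ (N : ℕ) → ∀ (n : ℕ) → N ≤ n →
          Iₙ dec q n + δ < inv (q ∸ 1)))
    × (∀ (ε : ℚ) → 0ℚ < ε → ∃ λ (Q : ℕ) → ∀ (q : ℕ) → Q ≤ q →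
        ∃ λ (N : ℕ) → ∀ (n : ℕ) → N ≤ n →
          ∣ ((+ (q ^ 3)) / 1) * (inv (q ∸ 1) - Iₙ dec q n) - 1ℚ ∣ < ε)
corollary3p5 dec = strict-bounds dec , asymptotics dec
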